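{- Let $n,N\ge3$ be integers, $(\Delta_n^i)_{2\le i\le N}$ an instruction set generator, and $(\sigma_1,\dots,\sigma_N)\in B_n$ with $\phi_n(\sigma_1,\dots,\sigma_N)=(v_{i_1},\dots,v_{i_N})$. Then for all integers $j\ge1$, $k\ge1$ with $j+k\le N$, $$v_{i_j}=v_{i_{j+k}}\iff \sigma_{j+1}\sigma_{j+2}\cdots\sigma_{j+k}(1)=1,$$ where $\sigma_{j+1}\sigma_{j+2}\cdots\sigma_{j+k}=\sigma_{j+k}\circ\cdots\circ\sigma_{j+1}$.
   Context: $S_n$ is the symmetric group on $\{1,\dots,n\}$, with composition written $\sigma_1\sigma_2=\sigma_2\circ\sigma_1$. An instruction set is a subset $\{f_2,\dots,f_n\}\subset S_n$ of $n-1$ permutations with $f_k(k)=1$. An instruction set generator is a family of functions $\Delta_n^i:S_n^{i-1}\to\mathcal{P}(S_n)$, $2\le i\le N$, each value being an instruction set. Let $V(K_n)=\{v_1,\dots,v_n\}$. $B_n$ is the set of columns $(\sigma_1,\dots,\sigma_N)$ with $\sigma_1=\mathrm{id}$, $\sigma_2=f_2\in\Delta_n^2(\mathrm{id})$, and $\sigma_i\in\Delta_n^i(\sigma_1,\dots,\sigma_{i-1})$ for $i\ge2$. $S_n$ acts on $n$-tuples of distinct elements of $V(K_n)$ by $\sigma\cdot(v_{s_1},\dots,v_{s_n})=(v_{s_{\sigma^{ -1}(1)}},\dots,v_{s_{\sigma^{ -1}(n)}})$. For $(\sigma_1,\dots,\sigma_N)\in B_n$ let $o_1=(v_1,\dots,v_n)$,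 $o_j=\sigma_j\cdot o_{j-1}$; $\phi_n(\sigma_1,\dots,\sigma_N)$ is the column whose $j$-th entry is the first coordinate of $o_j$. -}

module Defs where

open import Data.Nat using (ℕ; zero; suc; _+_; _∸_; _≤_; _<?_)
open import Data.Fin using (Fin; zero; suc; toℕ; fromℕ<)
open import Data.Fin.Permutation using (Permutation′; _⟨$⟩ʳ_; _⟨$⟩ˡ_; _∘ₚ_; _≈_) renaming (id to idₚ)
open import Data.Product using (Σ; _×_; _,_)
open import Relation.Binary.PropositionalEquality using (_≡_)
open import Relation.Nullary using (yes; no)

-- We work with n = suc m points; the point "1" of the paper is `zero`,
-- the point "k" (1 ≤ k ≤ n) is the Fin element with toℕ = k - 1.
Perm : ℕ → Set
Perm m = Permutation′ (suc m)

-- An instruction set {f_2,…,f_n} ⊂ S_n with f_k(k) = 1.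
-- The family is indexed by k ∈ {2,…,n}, i.e. by `suc t` for t : Fin m.
-- (Since f_k(k) = 1, the f_k are automatically pairwise distinct,
-- so the set has exactly n-1 elements.)
record InstructionSet (m : ℕ) : Set where
  field
    f    : Fin m → Perm m
    f-ok : (t : Fin m) → f t ⟨$⟩ʳ suc t ≡ zero
open InstructionSet public

_∈IS_ : {m : ℕ} → Perm m → InstructionSet m → Set
σ ∈IS S = Σ _ λ t → σ ≈ f S t

-- An instruction set generator: Δ i : S_n^{i-1} → instruction sets,
-- used for 2 ≤ i ≤ N (values for other i are irrelevant).
Generator : ℕ → Set
Generator m = (i : ℕ) → (Fin (i ∸ 1) → Perm m) → InstructionSet m

-- 1-based lookup in an N-tuple (Fin N → A); out of range returns a default.
at : {A : Set} {N : ℕ} → A → (Fin N → A) → ℕ → A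
at d xs zero = d
at {N = N} d xs (suc j) with j <? N
... | yes j<N = xs (fromℕ< j<N)
... | no _    = d

_!_ : {m N : ℕ} → (Fin N → Perm m) → ℕ → Perm m
σ ! j = at idₚ σ j

prefix : {m N : ℕ} → (Fin N → Perm m) → (i : ℕ) → Fin (i ∸ 1) → Perm m
prefix σ i t = σ ! suc (toℕ t)

InB : {m N : ℕ} → Generator m → (Fin N → Perm m) → Set
InB {m} {N} Δ σ =
  (σ ! 1 ≈ idₚ)
  × (Σ (Fin m) λ t → (toℕ t ≡ 0) × (σ ! 2 ≈ f (Δ 2 (prefix σ 2)) t))
  × ((i : ℕ) → 2 ≤ i → i ≤ N → (σ ! i) ∈IS Δ i (prefix σ i))

-- o_j as the map Fin n → Fin n, x ↦ s_x where o_j = (v_{s_1},…,v_{s_n}).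
-- o_1 = identity; o_j = σ_j · o_{j-1}, i.e. o_j(x) = o_{j-1}(σ_j^{-1}(x)).
orbit : {m N : ℕ} → (Fin N → Perm m) → ℕ → Fin (suc m) → Fin (suc m)
orbit σ zero x = x
orbit σ (suc zero) x = x
orbit σ (suc (suc j)) x = orbit σ (suc j) ((σ ! suc (suc j)) ⟨$⟩ˡ x)

-- φ_n(σ_1,…,σ_N): j-th entry (0-based index t, i.e. j = t+1) is the index
-- of the vertex in the first coordinate of o_j.
φ : {m N : ℕ} → (Fin N → Perm m) → Fin N → Fin (suc m)
φ σ t = orbit σ (suc (toℕ t)) zero

-- σ_{j+1} σ_{j+2} ⋯ σ_{j+k}  (= σ_{j+k} ∘ ⋯ ∘ σ_{j+1}); empty product = id.
prod : {m N : ℕ} → (Fin N → Perm m) → ℕ → ℕ → Perm m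
prod σ j zero = idₚ
prod σ j (suc k) = prod σ j k ∘ₚ (σ ! (j + suc k))

-- φ records where the vertex v₁ sits after the successive actions, and the
-- action on tuples is faithful: o_{j+k} = (σ_{j+1}⋯σ_{j+k}) · o_j, and
-- o_j is injective, so o_{j+k} and o_j have the same first coordinate
-- exactly when σ_{j+1}⋯σ_{j+k} fixes 1.
module Submission where

open import Defs
open import Data.Nat using (ℕ; zero; suc; _+_; _≤_; _<?_)
open import Data.Nat.Properties using (+-suc; +-identityʳ; ≤-trans; m≤m+n)
open import Data.Fin using (Fin; zero)
open import Data.Fin.Properties using (toℕ-fromℕ<)
open import Data.Fin.Permutation using (Permutation′; _⟨$⟩ʳ_; _⟨$⟩ˡ_; inverseˡ; inverseʳ)
open import Relation.Binary.PropositionalEquality using (_≡_; refl; sym; trans; cong)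
open import Relation.Nullary using (yes; no; contradiction)
open import Function.Bundles using (_⇔_; mk⇔; module Equivalence)

fixedˡ⇔fixedʳ : ∀ {n} (π : Permutation′ n) {x} → (π ⟨$⟩ˡ x ≡ x) ⇔ (π ⟨$⟩ʳ x ≡ x)
fixedˡ⇔fixedʳ π {x} = mk⇔
  (λ e → trans (sym (cong (π ⟨$⟩ʳ_) e)) (inverseʳ π))
  (λ e → trans (sym (cong (π ⟨$⟩ˡ_) e)) (inverseˡ π))

module _ {m N : ℕ} (σ : Fin N → Perm m) where

  orbit-+ : ∀ j k x → orbit σ (suc j + k) x ≡ orbit σ (suc j) (prod σ (suc j) k ⟨$⟩ˡ x)
  orbit-+ j zero    x rewrite +-identityʳ j = refl
  orbit-+ j (suc k) x rewrite +-suc j k     = orbit-+ j k ((σ ! suc (suc (j + k))) ⟨$⟩ˡ x)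

  orbit-injective : ∀ j {x y} → orbit σ j x ≡ orbit σ j y → x ≡ y
  orbit-injective zero          e = e
  orbit-injective (suc zero)    e = e
  orbit-injective (suc (suc j)) e =
    trans (sym (inverseʳ π)) (trans (cong (π ⟨$⟩ʳ_) (orbit-injective (suc j) e)) (inverseʳ π))
    where π = σ ! suc (suc j)

  at-φ≡orbit : ∀ j → suc j ≤ N → at zero (φ σ) (suc j) ≡ orbit σ (suc j) zero
  at-φ≡orbit j j<N with j <? N
  ... | yes p rewrite toℕ-fromℕ< p = refl
  ... | no ¬p = contradiction j<N ¬p

  φ-repeats⇔prod-fixes : ∀ j k → suc j + k ≤ N →
    (at zero (φ σ) (suc j) ≡ at zero (φ σ) (suc j + k)) ⇔ (prod σ (suc j) k ⟨$⟩ʳ zero ≡ zero)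
  φ-repeats⇔prod-fixes j k j+k≤N
    rewrite at-φ≡orbit j (≤-trans (m≤m+n (suc j) k) j+k≤N)
          | at-φ≡orbit (j + k) j+k≤N
          | orbit-+ j k zero
    = mk⇔ (λ e → Equivalence.to fixedˡ (sym (orbit-injective (suc j) e)))
          (λ e → cong (orbit σ (suc j)) (sym (Equivalence.from fixedˡ e)))
    where
    fixedˡ = fixedˡ⇔fixedʳ (prod σ (suc j) k)

lemma28 : (m N : ℕ) → 3 ≤ suc m → 3 ≤ N → (Δ : Generator m)
    → (σ : Fin N → Perm m) → InB Δ σ
    → (j k : ℕ) → 1 ≤ j → 1 ≤ k → j + k ≤ N
    → (at zero (φ σ) j ≡ at zero (φ σ) (j + k)) ⇔ (prod σ j k ⟨$⟩ʳ zero ≡ zero)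
lemma28 m N _ _ Δ σ _ (suc j) k _ _ j+k≤N = φ-repeats⇔prod-fixes σ j k j+k≤N
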